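{- Let $\kappa\in(0,1)$, let $G_\kappa$ be a $\kappa$-template-graph on $[n]$ and let $\vec G_\kappa$ be any orientation of $G_\kappa$. Then for every set $W\subset[n]$ of size $n^{2/3}$ and every subset $S\subseteq F(W)$ of size at least $\kappa n^{2/3}$, the set $S$ $(1-\kappa)$-covers $W$, i.e. $|N^+(S)\cap W|\geq(1-\kappa)|W|$.
   Context: A $\kappa$-template-graph is an undirected graph $G$ on $[n]$ such that for every pair of disjoint $H_1,H_2\subseteq[n]$, both of size at least $\kappa n^{2/3}$, there is an edge of $G$ between $H_1$ and $H_2$. An orientation replaces each edge by one of its two arcs. All out-neighbourhoods refer to $\vec G_\kappa$; for a set $X$, $N^+(X)=\bigcup_{x\in X}N^+(x)$. The free set of $W$ is $F(W)=[n]\setminus(N^+(W)\cup W)$. A set $S$ $\alpha$-covers $W$ if $|N^+(S)\cap W|\geq\alpha|W|$. It is assumed that $n^{2/3}$ is an integer.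
   Formalization: The parameter κ ranges only over the rationals in (0,1), both in the template-graph property and in the covering bound. -}

module Defs where

open import Data.Nat using (ℕ; _*_)
open import Data.Bool using (Bool; true; false; _∧_; _∨_)
open import Data.Fin using (Fin)
open import Data.Fin.Subset using (Subset; _∈_; _∪_; ∁; _∩_; ∣_∣; Empty)
open import Data.Vec using (tabulate; lookup; foldr′)
open import Data.Integer using (+_)
open import Data.Rational using (ℚ; _/_) renaming (_*_ to _*ℚ_; _≤_ to _≤ℚ_)
open import Data.Product using (Σ; _×_)
open import Data.Sum using (_⊎_)
open import Relation.Binary.PropositionalEquality using (_≡_)

ℕ→ℚ : ℕ → ℚ
ℕ→ℚ k = + k / 1

record Graph (n : ℕ) : Set where
  field
    adj    : Fin n → Fin n → Bool
    sym    : ∀ x y → adj x y ≡ adj y x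
    irrefl : ∀ x → adj x x ≡ false
open Graph public

record Orientation {n : ℕ} (G : Graph n) : Set where
  field
    arc      : Fin n → Fin n → Bool
    arc⇒edge : ∀ x y → arc x y ≡ true → adj G x y ≡ true
    edge⇒arc : ∀ x y → adj G x y ≡ true → (arc x y ≡ true) ⊎ (arc y x ≡ true)
    oneArc   : ∀ x y → arc x y ≡ true → arc y x ≡ false
open Orientation public

-- κ-template-graph, where m plays the role of n^{2/3}
IsTemplateGraph : (κ : ℚ) (n m : ℕ) → Graph n → Set
IsTemplateGraph κ n m G =
  ∀ (H₁ H₂ : Subset n) → Empty (H₁ ∩ H₂) →
  (κ *ℚ ℕ→ℚ m) ≤ℚ ℕ→ℚ ∣ H₁ ∣ → (κ *ℚ ℕ→ℚ m) ≤ℚ ℕ→ℚ ∣ H₂ ∣ →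
  Σ (Fin n) λ x → Σ (Fin n) λ y → (x ∈ H₁) × (y ∈ H₂) × (adj G x y ≡ true)

anyFin : {n : ℕ} → (Fin n → Bool) → Bool
anyFin f = foldr′ _∨_ false (tabulate f)

N⁺ : {n : ℕ} {G : Graph n} → Orientation G → Subset n → Subset n
N⁺ D X = tabulate λ y → anyFin λ x → lookup X x ∧ arc D x y

Free : {n : ℕ} {G : Graph n} → Orientation G → Subset n → Subset n
Free D W = ∁ (N⁺ D W ∪ W)

Covers : {n : ℕ} {G : Graph n} → Orientation G → ℚ → Subset n → Subset n → Set
Covers D α S W = (α *ℚ ℕ→ℚ ∣ W ∣) ≤ℚ ℕ→ℚ ∣ N⁺ D S ∩ W ∣

-- Let H = W ∖ N⁺(S) be the part of W that S fails to cover. H is disjoint from S, because S lies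
-- in the free set of W, and there is no edge between S and H: an arc s → h would put h into
-- N⁺(S), and an arc h → s would put s into N⁺(W). The template property therefore forces
-- |H| < κ n^{2/3} = κ |W|, so |N⁺(S) ∩ W| = |W| − |H| ≥ (1 − κ) |W|.
module Submission where

open import Defs hiding (sym)
open import Data.Nat using (ℕ; _*_; suc; _+_)
import Data.Nat.Properties as ℕ
open import Data.Nat.Coprimality using (1-coprimeTo)
import Data.Nat.Coprimality as Coprimality
open import Data.Integer using (+_)
import Data.Integer as ℤ
import Data.Integer.Properties as ℤ
open import Data.Rational using (ℚ; 0ℚ; 1ℚ; _<_; _-_; mkℚ)
  renaming (_*_ to _*ℚ_; _≤_ to _≤ℚ_; _+_ to _+ℚ_)
import Data.Rational.Properties as ℚ
open import Data.Rational.Solver using (module +-*-Solver)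
import Data.Rational.Unnormalised as ℚᵘ
import Data.Rational.Unnormalised.Properties as ℚᵘ
open import Data.Bool using (Bool; true; _∧_)
open import Data.Bool.Properties using (∨-zeroʳ)
open import Data.Fin using (Fin; zero; suc)
open import Data.Fin.Subset using (Subset; _⊆_; ∣_∣; _∩_; ∁; _∈_; Empty; inside; outside)
open import Data.Fin.Subset.Properties using (x∈p∩q⁻; x∈p∪q⁺; x∈∁p⇒x∉p; ∩-comm)
open import Data.Vec using ([]; _∷_; lookup)
open import Data.Vec.Properties using (lookup∘tabulate; []=⇒lookup; lookup⇒[]=)
open import Data.Product using (_,_)
open import Data.Sum using (inj₁; inj₂)
open import Data.Empty using (⊥-elim)
open import Relation.Nullary using (¬_; yes; no)
open import Relation.Binary.PropositionalEquality
  using (_≡_; refl; sym; trans; cong; cong₂)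

-- ℕ→ℚ k = + k / 1 goes through gcd normalisation, which does not compute for a variable k.
mkℚ-ℕ : ℕ → ℚ
mkℚ-ℕ k = mkℚ (+ k) 0 (Coprimality.sym (1-coprimeTo k))

ℕ→ℚ≡mkℚ-ℕ : ∀ k → ℕ→ℚ k ≡ mkℚ-ℕ k
ℕ→ℚ≡mkℚ-ℕ k = ℚ.normalize-coprime (Coprimality.sym (1-coprimeTo k))

ℕ→ℚ-homo-+ : ∀ a b → ℕ→ℚ (a + b) ≡ ℕ→ℚ a +ℚ ℕ→ℚ b
ℕ→ℚ-homo-+ a b rewrite ℕ→ℚ≡mkℚ-ℕ a | ℕ→ℚ≡mkℚ-ℕ b | ℕ→ℚ≡mkℚ-ℕ (a + b) =
  ℚ.toℚᵘ-injective (ℚᵘ.≃-trans sum≃ (ℚᵘ.≃-sym (ℚ.toℚᵘ-homo-+ (mkℚ-ℕ a) (mkℚ-ℕ b))))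
  where
  sum≃ : ℚᵘ.mkℚᵘ (+ (a + b)) 0 ℚᵘ.≃ ℚᵘ.mkℚᵘ (+ a) 0 ℚᵘ.+ ℚᵘ.mkℚᵘ (+ b) 0
  sum≃ = ℚᵘ.*≡* (cong (ℤ._* + 1) (trans (ℤ.pos-+ a b)
           (sym (cong₂ ℤ._+_ (ℤ.*-identityʳ (+ a)) (ℤ.*-identityʳ (+ b))))))

h≤κw⇒[1-κ]w≤a : ∀ κ {a h w} → w ≡ a +ℚ h → h ≤ℚ κ *ℚ w → (1ℚ - κ) *ℚ w ≤ℚ a
h≤κw⇒[1-κ]w≤a κ {a} {h} refl h≤κw = begin
  (1ℚ - κ) *ℚ (a +ℚ h)           ≡⟨ split ⟩
  a +ℚ (h - κ *ℚ (a +ℚ h))       ≤⟨ ℚ.+-monoʳ-≤ a (ℚ.+-monoʳ-≤ h (ℚ.neg-antimono-≤ h≤κw)) ⟩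
  a +ℚ (h - h)                   ≡⟨ cong (a +ℚ_) (ℚ.+-inverseʳ h) ⟩
  a +ℚ 0ℚ                        ≡⟨ ℚ.+-identityʳ a ⟩
  a                              ∎
  where
  open ℚ.≤-Reasoning
  open +-*-Solver
  split : (1ℚ - κ) *ℚ (a +ℚ h) ≡ a +ℚ (h - κ *ℚ (a +ℚ h))
  split = solve 3 (λ κ a h → (con 1ℚ :- κ) :* (a :+ h) := a :+ (h :- κ :* (a :+ h))) refl κ a h

∣p∩q∣+∣p∩∁q∣≡∣p∣ : ∀ {n} (p q : Subset n) → ∣ p ∩ q ∣ + ∣ p ∩ ∁ q ∣ ≡ ∣ p ∣
∣p∩q∣+∣p∩∁q∣≡∣p∣ []            []            = refl
∣p∩q∣+∣p∩∁q∣≡∣p∣ (inside  ∷ p) (inside  ∷ q) = cong suc (∣p∩q∣+∣p∩∁q∣≡∣p∣ p q)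
∣p∩q∣+∣p∩∁q∣≡∣p∣ (inside  ∷ p) (outside ∷ q) =
  trans (ℕ.+-suc ∣ p ∩ q ∣ ∣ p ∩ ∁ q ∣) (cong suc (∣p∩q∣+∣p∩∁q∣≡∣p∣ p q))
∣p∩q∣+∣p∩∁q∣≡∣p∣ (outside ∷ p) (_       ∷ q) = ∣p∩q∣+∣p∩∁q∣≡∣p∣ p q

anyFin⁺ : ∀ {n} (f : Fin n → Bool) x → f x ≡ true → anyFin f ≡ true
anyFin⁺ f zero    fx≡true rewrite fx≡true = refl
anyFin⁺ f (suc x) fx≡true rewrite anyFin⁺ (λ i → f (suc i)) x fx≡true = ∨-zeroʳ (f zero)

arc⇒∈N⁺ : ∀ {n} {G : Graph n} (D : Orientation G) {X : Subset n} {x y} →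
          x ∈ X → arc D x y ≡ true → y ∈ N⁺ D X
arc⇒∈N⁺ D {X} {x} {y} x∈X xy≡true = lookup⇒[]= y _
  (trans (lookup∘tabulate _ y) (anyFin⁺ (λ z → lookup X z ∧ arc D z y) x x∧xy≡true))
  where
  x∧xy≡true : lookup X x ∧ arc D x y ≡ true
  x∧xy≡true rewrite []=⇒lookup x∈X = xy≡true

Uncovered : ∀ {n} {G : Graph n} → Orientation G → Subset n → Subset n → Subset n
Uncovered D S W = W ∩ ∁ (N⁺ D S)

module _ {n} {G : Graph n} (D : Orientation G) {W S : Subset n} (S⊆F : S ⊆ Free D W) where

  Free-disjoint-Uncovered : Empty (S ∩ Uncovered D S W)
  Free-disjoint-Uncovered (x , x∈S∩H) with x∈p∩q⁻ S _ x∈S∩H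
  ... | x∈S , x∈H with x∈p∩q⁻ W _ x∈H
  ...   | x∈W , _ = x∈∁p⇒x∉p (S⊆F x∈S) (x∈p∪q⁺ (inj₂ x∈W))

  Free-noEdge-Uncovered : ∀ {x y} → x ∈ S → y ∈ Uncovered D S W → ¬ (adj G x y ≡ true)
  Free-noEdge-Uncovered {x} {y} x∈S y∈H xy∈G with x∈p∩q⁻ W _ y∈H | edge⇒arc D x y xy∈G
  ... | _   , y∉N⁺S | inj₁ x→y = x∈∁p⇒x∉p y∉N⁺S (arc⇒∈N⁺ D x∈S x→y)
  ... | y∈W , _     | inj₂ y→x = x∈∁p⇒x∉p (S⊆F x∈S) (x∈p∪q⁺ (inj₁ (arc⇒∈N⁺ D y∈W y→x)))

  Template⇒Uncovered-small : ∀ {κ m} → IsTemplateGraph κ n m G → κ *ℚ ℕ→ℚ m ≤ℚ ℕ→ℚ ∣ S ∣ →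
                             ℕ→ℚ ∣ Uncovered D S W ∣ < κ *ℚ ℕ→ℚ m
  Template⇒Uncovered-small {κ} {m} template κm≤S
    with κ *ℚ ℕ→ℚ m ℚ.≤? ℕ→ℚ ∣ Uncovered D S W ∣
  ... | no  κm≰H = ℚ.≰⇒> κm≰H
  ... | yes κm≤H with template S (Uncovered D S W) Free-disjoint-Uncovered κm≤S κm≤H
  ...   | _ , _ , x∈S , y∈H , xy∈G = ⊥-elim (Free-noEdge-Uncovered x∈S y∈H xy∈G)

Uncovered-small⇒Covers : ∀ {n} {G : Graph n} (D : Orientation G) κ (S W : Subset n) →
                         ℕ→ℚ ∣ Uncovered D S W ∣ ≤ℚ κ *ℚ ℕ→ℚ ∣ W ∣ → Covers D (1ℚ - κ) S W
Uncovered-small⇒Covers D κ S W = h≤κw⇒[1-κ]w≤a κ W≡a+h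
  where
  W≡a+h : ℕ→ℚ ∣ W ∣ ≡ ℕ→ℚ ∣ N⁺ D S ∩ W ∣ +ℚ ℕ→ℚ ∣ Uncovered D S W ∣
  W≡a+h rewrite ∩-comm (N⁺ D S) W =
    trans (cong ℕ→ℚ (sym (∣p∩q∣+∣p∩∁q∣≡∣p∣ W (N⁺ D S))))
          (ℕ→ℚ-homo-+ ∣ W ∩ N⁺ D S ∣ ∣ Uncovered D S W ∣)

lemma12 : (κ : ℚ) → 0ℚ < κ → κ < 1ℚ →
    (n m : ℕ) → m * m * m ≡ n * n →
    (G : Graph n) → IsTemplateGraph κ n m G →
    (D : Orientation G) →
    (W : Subset n) → ∣ W ∣ ≡ m →
    (S : Subset n) → S ⊆ Free D W → (κ *ℚ ℕ→ℚ m) ≤ℚ ℕ→ℚ ∣ S ∣ →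
    Covers D (1ℚ - κ) S W
lemma12 κ _ _ n m _ G template D W refl S S⊆F κm≤S =
  Uncovered-small⇒Covers D κ S W (ℚ.<⇒≤ (Template⇒Uncovered-small D S⊆F {κ} {m} template κm≤S))
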